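{- Let $n,x,a$ be integers such that $x$ is odd, $1<x<n$ and $\frac{n}{2}\leq a<n$. There exists a perfect matching $F$ of $K_{2n}$ such that $\ell(F)=\{1^a,x^{n-a}\}$.
   Context: For a positive integer $v$, $K_v$ denotes the complete graph on the vertex set $\{0,1,\ldots,v-1\}$. The length of an edge $\{u,w\}$ of $K_v$ is $\ell(u,w)=\min(|u-w|,\,v-|u-w|)$. For a subgraph $\Gamma$ of $K_v$, $\ell(\Gamma)$ is the list (multiset) of lengths of all edges of $\Gamma$, counted with multiplicity. A perfect matching of $K_{2n}$ is a set of $n$ pairwise disjoint edges covering all vertices. $\{1^a,x^b\}$ denotes the list with $a$ copies of $1$ and $b$ copies of $x$. -}

module Defs where

open import Data.Nat using (ℕ; _+_; _*_; _∸_; _<_; _≤_; _⊓_)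
open import Data.Nat.Properties using ()
open import Data.Product using (_×_; _,_; proj₁; proj₂; Σ-syntax)
open import Data.List using (List; []; _∷_; map; concatMap; length; replicate; _++_)
open import Data.List.Relation.Unary.All using (All)
open import Data.List.Relation.Unary.Unique.Propositional using (Unique)
open import Data.List.Membership.Propositional using (_∈_)
open import Data.List.Relation.Binary.Permutation.Propositional using (_↭_)
open import Relation.Binary.PropositionalEquality using (_≢_)

dist : ℕ → ℕ → ℕ
dist u w = (u ∸ w) + (w ∸ u)

edgeLength : ℕ → ℕ → ℕ → ℕ
edgeLength v u w = dist u w ⊓ (v ∸ dist u w)

-- An edge of K_v is represented as an (unordered) pair of vertices
Edge : Set
Edge = ℕ × ℕ

endpoints : List Edge → List ℕ
endpoints = concatMap (λ e → proj₁ e ∷ proj₂ e ∷ [])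

IsEdge : ℕ → Edge → Set
IsEdge v (u , w) = (u < v) × (w < v) × (u ≢ w)

IsPerfectMatching : ℕ → List Edge → Set
IsPerfectMatching v F =
  All (IsEdge v) F × Unique (endpoints F) × (∀ (u : ℕ) → u < v → u ∈ endpoints F)

lengths : ℕ → List Edge → List ℕ
lengths v F = map (λ e → edgeLength v (proj₁ e) (proj₂ e)) F

-- Put b = n − a and e = n − x, so 1 ≤ b ≤ a and e ≥ 1.  An edge of K_{2n} has length x exactly
-- when its endpoints differ by x or by 2n − x = x + 2e, and length 1 when they differ by 1.
--
-- On the path 0, …, 2n − 1, j ≤ x interleaved chords {s + i, s + i + x} (i < j) leave x − j
-- vertices between their two ends; for j odd these are paired by unit edges.  Writing
-- b = q x + r with 1 ≤ r ≤ x, the b chords fit into q full blocks (j = x) and one block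
-- (r odd) or two blocks of r − 1 and 1 chords (r even), followed by unit edges, unless the
-- blocks need more than a unit edges.  That happens only when b is even, b < x and
-- 2x + b > 2n, i.e. e < b/2; then chords have to wrap around.  If e is odd, then n is even
-- and an arrangement of b/2 chords of difference e on the path 0, …, n − 1 lifts to K_{2n}: the
-- chord {u, u + e} becomes {u + e, n + u} and {u, n + u + e}, unit edges are copied to both halves.
-- If e is even, the vertices are laid out in two rows [0, n − 1) and [n − 1, 2n), joined by
-- crossing pieces carrying 2(r + 1) chords each, for odd r ≤ e − 1; a single extra piece with
-- two chords accounts for b/2 being odd.

module Submission where

open import Defs
open import Data.Nat using (ℕ; zero; suc; _+_; _*_; _∸_; _<_; _≤_; _⊓_; z≤n; s≤s; z<s; NonZero)
open import Data.Nat.DivMod using (_/_; _%_; m≡m%n+[m/n]*n; m%n<n)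
open import Data.Nat.Properties
open import Data.Product using (_×_; _,_; proj₁; proj₂; Σ-syntax)
open import Data.Sum as Sum using (_⊎_; inj₁; inj₂)
open import Function using (_∘_)
open import Data.List using (List; []; _∷_; [_]; map; length; replicate; _++_)
open import Data.List.Properties using (length-++; length-map; map-++; ++-identityʳ; concatMap-++)
open import Data.List.Relation.Unary.All as All using (All; []; _∷_)
open import Data.List.Relation.Unary.All.Properties using (++⁺; map⁺)
open import Data.List.Relation.Unary.Any using (here; there)
open import Data.List.Relation.Unary.AllPairs using ([]; _∷_)
open import Data.List.Relation.Unary.Unique.Propositional using (Unique)
open import Data.List.Membership.Propositional using (_∈_)
open import Data.List.Relation.Binary.Permutation.Propositional
  using (_↭_; prep; ↭-refl; ↭-sym; ↭-trans; ↭-reflexive; ↭⇒↭ₛ; module PermutationReasoning)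
open import Data.List.Relation.Binary.Permutation.Propositional.Properties
  using (All-resp-↭; ∈-resp-↭; ++-comm; ++-commutativeMonoid; shift)
  renaming (++⁺ to ↭-++⁺; ++⁺ˡ to ↭-++⁺ˡ; ++⁺ʳ to ↭-++⁺ʳ; map⁺ to ↭-map⁺)
open import Data.List.Relation.Binary.Permutation.Setoid.Properties as Setoidₚ using ()
open import Relation.Binary.PropositionalEquality hiding ([_])
open import Relation.Nullary using (yes; no; contradiction)
open import Data.Nat.Tactic.RingSolver using (solve-∀)
open import Algebra.Solver.CommutativeMonoid (++-commutativeMonoid {A = ℕ})
  using (solve; _⊜_; _⊕_)

parity : ∀ n → (Σ[ σ ∈ ℕ ] n ≡ σ + σ) ⊎ (Σ[ σ ∈ ℕ ] n ≡ suc (σ + σ))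
parity zero    = inj₁ (0 , refl)
parity (suc n) with parity n
... | inj₁ (σ , refl) = inj₂ (σ , refl)
... | inj₂ (σ , refl) = inj₁ (suc σ , cong suc (sym (+-suc σ σ)))

half-≤ : ∀ {m n} → m + m ≤ suc (n + n) → m ≤ n
half-≤ {m} {n} m+m≤1+n+n with m ≤? n
... | yes m≤n = m≤n
... | no  m≰n = contradiction m+m≤1+n+n
  (<⇒≱ (subst (_≤ m + m) (cong suc (+-suc n n)) (+-mono-≤ (≰⇒> m≰n) (≰⇒> m≰n))))

odd-split : ∀ σ h → suc ((σ + h) + (σ + h)) ≡ suc (σ + σ) + (h + h)
odd-split = solve-∀

divide : ∀ c d .{{_ : NonZero d}} → Σ[ q ∈ ℕ ] Σ[ ρ ∈ ℕ ] ρ < d × c ≡ q * d + ρ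
divide c d = c / d , c % d , m%n<n c d , trans (m≡m%n+[m/n]*n c d) (+-comm (c % d) _)

odd-regroup : ∀ γ h → suc ((γ + h) + (γ + h)) ≡ suc γ + (h + (γ + h))
odd-regroup = solve-∀

range : ℕ → ℕ → List ℕ
range s zero    = []
range s (suc k) = s ∷ range (suc s) k

range-++ : ∀ s p q → range s p ++ range (s + p) q ≡ range s (p + q)
range-++ s zero    q = cong (λ t → range t q) (+-identityʳ s)
range-++ s (suc p) q = cong (s ∷_)
  (trans (cong (λ t → range (suc s) p ++ range t q) (+-suc s p)) (range-++ (suc s) p q))

range-join : ∀ {s p t q} → t ≡ s + p → range s p ++ range t q ≡ range s (p + q)
range-join {s} {p} refl = range-++ s p _

range-shift : ∀ m s k → map (m +_) (range s k) ≡ range (m + s) k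
range-shift m s zero    = refl
range-shift m s (suc k) = cong (m + s ∷_) (trans (range-shift m (suc s) k) (cong (λ t → range t k) (+-suc m s)))

range-lower : ∀ s k → All (s ≤_) (range s k)
range-lower s zero    = []
range-lower s (suc k) = ≤-refl ∷ All.map (λ s<u → <⇒≤ s<u) (range-lower (suc s) k)

range-upper : ∀ s k → All (_< s + k) (range s k)
range-upper s zero    = []
range-upper s (suc k) = m<m+n s z<s
  ∷ subst (λ t → All (_< t) (range (suc s) k)) (sym (+-suc s k)) (range-upper (suc s) k)

range-unique : ∀ s k → Unique (range s k)
range-unique s zero    = []
range-unique s (suc k) = All.map (λ s<u s≡u → <⇒≢ s<u s≡u) (range-lower (suc s) k) ∷ range-unique (suc s) k

range-complete : ∀ s k {u} → s ≤ u → u < s + k → u ∈ range s k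
range-complete s zero    s≤u u<s = contradiction (subst (_ <_) (+-identityʳ s) u<s) (≤⇒≯ s≤u)
range-complete s (suc k) {u} s≤u u<s with s ≟ u
... | yes refl = here refl
... | no s≢u   = there (range-complete (suc s) k (≤∧≢⇒< s≤u s≢u) (subst (u <_) (+-suc s k) u<s))

_spans_ : Edge → ℕ → Set
e spans d = proj₂ e ≡ proj₁ e + d

chords : ℕ → ℕ → ℕ → List Edge
chords d s zero    = []
chords d s (suc j) = (s , s + d) ∷ chords d (suc s) j

pairs : ℕ → ℕ → List Edge
pairs s zero    = []
pairs s (suc h) = (s , suc s) ∷ pairs (suc (suc s)) h

endpoints-++ : ∀ F G → endpoints (F ++ G) ≡ endpoints F ++ endpoints G
endpoints-++ = concatMap-++ _

chords-spans : ∀ d s j → All (_spans d) (chords d s j)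
chords-spans d s zero    = []
chords-spans d s (suc j) = refl ∷ chords-spans d (suc s) j

chords-length : ∀ d s j → length (chords d s j) ≡ j
chords-length d s zero    = refl
chords-length d s (suc j) = cong suc (chords-length d (suc s) j)

chords-endpoints : ∀ d s j → endpoints (chords d s j) ↭ range s j ++ range (s + d) j
chords-endpoints d s zero    = ↭-refl
chords-endpoints d s (suc j) = prep s (↭-trans (prep (s + d) (chords-endpoints d (suc s) j))
  (↭-sym (shift (s + d) (range (suc s) j) (range (suc (s + d)) j))))

pairs-spans : ∀ s h → All (_spans 1) (pairs s h)
pairs-spans s zero    = []
pairs-spans s (suc h) = +-comm 1 s ∷ pairs-spans (suc (suc s)) h

pairs-length : ∀ s h → length (pairs s h) ≡ h
pairs-length s zero    = refl
pairs-length s (suc h) = cong suc (pairs-length (suc (suc s)) h)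

pairs-endpoints : ∀ s h → endpoints (pairs s h) ≡ range s (h + h)
pairs-endpoints s zero    = refl
pairs-endpoints s (suc h) = cong (s ∷_)
  (trans (cong (suc s ∷_) (pairs-endpoints (suc (suc s)) h)) (cong (range (suc s)) (sym (+-suc h h))))

record Matching (Long : Edge → Set) (V : List ℕ) (c p : ℕ) : Set where
  field
    long short  : List Edge
    long-spans  : All Long long
    short-spans : All (_spans 1) short
    long-count  : length long ≡ c
    short-count : length short ≡ p
    covers      : endpoints long ++ endpoints short ↭ V

open Matching

interchange : ∀ (A B C D : List ℕ) → (A ++ B) ++ (C ++ D) ↭ (A ++ C) ++ (B ++ D)
interchange = solve 4 (λ A B C D → (A ⊕ B) ⊕ (C ⊕ D) ⊜ (A ⊕ C) ⊕ (B ⊕ D)) ↭-refl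

module _ {Long : Edge → Set} where

  _∪_ : ∀ {V V' c c' p p'} → Matching Long V c p → Matching Long V' c' p' →
        Matching Long (V ++ V') (c + c') (p + p')
  M ∪ N = record
    { long        = long M ++ long N
    ; short       = short M ++ short N
    ; long-spans  = ++⁺ (long-spans M) (long-spans N)
    ; short-spans = ++⁺ (short-spans M) (short-spans N)
    ; long-count  = trans (length-++ (long M)) (cong₂ _+_ (long-count M) (long-count N))
    ; short-count = trans (length-++ (short M)) (cong₂ _+_ (short-count M) (short-count N))
    ; covers      = begin
        endpoints (long M ++ long N) ++ endpoints (short M ++ short N)
          ≡⟨ cong₂ _++_ (endpoints-++ (long M) (long N)) (endpoints-++ (short M) (short N)) ⟩
        (endpoints (long M) ++ endpoints (long N)) ++ (endpoints (short M) ++ endpoints (short N))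
          ↭⟨ interchange (endpoints (long M)) (endpoints (long N)) (endpoints (short M)) (endpoints (short N)) ⟩
        (endpoints (long M) ++ endpoints (short M)) ++ (endpoints (long N) ++ endpoints (short N))
          ↭⟨ ↭-++⁺ (covers M) (covers N) ⟩
        _ ∎
    }
    where open PermutationReasoning

  reshape : ∀ {V V' c c' p p'} → V ↭ V' → c ≡ c' → p ≡ p' →
            Matching Long V c p → Matching Long V' c' p'
  reshape V↭V' refl refl M = record
    { long = long M ; short = short M ; long-spans = long-spans M ; short-spans = short-spans M
    ; long-count = long-count M ; short-count = short-count M ; covers = ↭-trans (covers M) V↭V' }

  no-edges : Matching Long [] 0 0
  no-edges = record
    { long = [] ; short = [] ; long-spans = [] ; short-spans = []
    ; long-count = refl ; short-count = refl ; covers = ↭-refl }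

  pairs-matching : ∀ s h → Matching Long (range s (h + h)) 0 h
  pairs-matching s h = record
    { long = [] ; short = pairs s h ; long-spans = [] ; short-spans = pairs-spans s h
    ; long-count = refl ; short-count = pairs-length s h
    ; covers = ↭-reflexive (pairs-endpoints s h) }

weaken : ∀ {L L' : Edge → Set} {V c p} → (∀ {e} → L e → L' e) → Matching L V c p → Matching L' V c p
weaken L⇒L' M = record
  { long = long M ; short = short M ; long-spans = All.map L⇒L' (long-spans M) ; short-spans = short-spans M
  ; long-count = long-count M ; short-count = short-count M ; covers = covers M }

chords-matching : ∀ d s j → Matching (_spans d) (range s j ++ range (s + d) j) j 0
chords-matching d s j = record
  { long = chords d s j ; short = [] ; long-spans = chords-spans d s j ; short-spans = []
  ; long-count = chords-length d s j ; short-count = refl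
  ; covers = ↭-trans (↭-reflexive (++-identityʳ _)) (chords-endpoints d s j) }

HasLength : ℕ → ℕ → Edge → Set
HasLength N ℓ e = edgeLength N (proj₁ e) (proj₂ e) ≡ ℓ

dist-+ : ∀ u d → dist u (u + d) ≡ d
dist-+ u d = cong₂ _+_ (m≤n⇒m∸n≡0 (m≤m+n u d)) (m+n∸m≡n u d)

≤-∸-half : ∀ {ℓ N} → ℓ + ℓ ≤ N → ℓ ≤ N ∸ ℓ
≤-∸-half {ℓ} {N} ℓ+ℓ≤N = subst (_≤ N ∸ ℓ) (m+n∸n≡m ℓ ℓ) (∸-monoˡ-≤ ℓ ℓ+ℓ≤N)

spans⇒length : ∀ {N ℓ e} → ℓ + ℓ ≤ N → e spans ℓ → HasLength N ℓ e
spans⇒length {N} {ℓ} {u , _} ℓ+ℓ≤N refl = begin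
  dist u (u + ℓ) ⊓ (N ∸ dist u (u + ℓ)) ≡⟨ cong (λ d → d ⊓ (N ∸ d)) (dist-+ u ℓ) ⟩
  ℓ ⊓ (N ∸ ℓ)                           ≡⟨ m≤n⇒m⊓n≡m (≤-∸-half ℓ+ℓ≤N) ⟩
  ℓ                                     ∎
  where open ≡-Reasoning

spans-complement⇒length : ∀ {N ℓ e} → ℓ + ℓ ≤ N → e spans (N ∸ ℓ) → HasLength N ℓ e
spans-complement⇒length {N} {ℓ} {u , _} ℓ+ℓ≤N refl = begin
  dist u (u + (N ∸ ℓ)) ⊓ (N ∸ dist u (u + (N ∸ ℓ))) ≡⟨ cong (λ d → d ⊓ (N ∸ d)) (dist-+ u (N ∸ ℓ)) ⟩
  (N ∸ ℓ) ⊓ (N ∸ (N ∸ ℓ))                           ≡⟨ cong ((N ∸ ℓ) ⊓_) (m∸[m∸n]≡n ℓ≤N) ⟩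
  (N ∸ ℓ) ⊓ ℓ                                       ≡⟨ m≥n⇒m⊓n≡n (≤-∸-half ℓ+ℓ≤N) ⟩
  ℓ                                                 ∎
  where
  open ≡-Reasoning
  ℓ≤N = ≤-trans (m≤m+n ℓ ℓ) ℓ+ℓ≤N

chord-length : ∀ {N ℓ ℓ' e} → ℓ + ℓ' ≡ N → ℓ ≤ ℓ' → e spans ℓ ⊎ e spans ℓ' → HasLength N ℓ e
chord-length {N} {ℓ} {ℓ'} {e} ℓ+ℓ'≡N ℓ≤ℓ' = λ
  { (inj₁ s) → spans⇒length ℓ+ℓ≤N s
  ; (inj₂ s) → spans-complement⇒length ℓ+ℓ≤N (subst (e spans_) ℓ'≡N∸ℓ s) }
  where
  ℓ+ℓ≤N = subst (ℓ + ℓ ≤_) ℓ+ℓ'≡N (+-monoʳ-≤ ℓ ℓ≤ℓ')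
  ℓ'≡N∸ℓ = sym (trans (cong (_∸ ℓ) (sym ℓ+ℓ'≡N)) (m+n∸m≡n ℓ ℓ'))

edges-from-unique : ∀ N F → Unique (endpoints F) → All (_< N) (endpoints F) → All (IsEdge N) F
edges-from-unique N []            _                    _               = []
edges-from-unique N ((u , w) ∷ F) ((u≢w ∷ _) ∷ _ ∷ uq) (u<N ∷ w<N ∷ bd) =
  (u<N , w<N , u≢w) ∷ edges-from-unique N F uq bd

perfect-matching : ∀ N F → endpoints F ↭ range 0 N → IsPerfectMatching N F
perfect-matching N F F↭ =
  edges-from-unique N F unique bounded , unique , λ u u<N → ∈-resp-↭ (↭-sym F↭) (range-complete 0 N z≤n u<N)
  where
  unique = Setoidₚ.Unique-resp-↭ (setoid ℕ) (↭⇒↭ₛ (↭-sym F↭)) (range-unique 0 N)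
  bounded = All-resp-↭ (↭-sym F↭) (range-upper 0 N)

map-constant : ∀ {A : Set} (f : A → ℕ) {v} xs → All (λ x → f x ≡ v) xs → map f xs ≡ replicate (length xs) v
map-constant f []       []         = refl
map-constant f (x ∷ xs) (fx≡v ∷ p) = cong₂ _∷_ fx≡v (map-constant f xs p)

Solution : ℕ → ℕ → ℕ → Set
Solution n x a = Σ[ F ∈ List Edge ] (IsPerfectMatching (2 * n) F ×
  (lengths (2 * n) F ↭ (replicate a 1 ++ replicate (n ∸ a) x)))

matching⇒solution : ∀ {n x a} → 1 ≤ n →
  Matching (HasLength (2 * n) x) (range 0 (2 * n)) (n ∸ a) a → Solution n x a
matching⇒solution {n} {x} {a} 1≤n M = long M ++ short M , perfect-matching (2 * n) _ covers′ , lengths↭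
  where
  covers′ = ↭-trans (↭-reflexive (endpoints-++ (long M) (short M))) (covers M)
  len : Edge → ℕ
  len e = edgeLength (2 * n) (proj₁ e) (proj₂ e)
  unit : ∀ {e} → e spans 1 → HasLength (2 * n) 1 e
  unit = spans⇒length (*-monoʳ-≤ 2 1≤n)
  lengths↭ = begin
    lengths (2 * n) (long M ++ short M)     ≡⟨ map-++ len (long M) (short M) ⟩
    map len (long M) ++ map len (short M)   ≡⟨ cong₂ _++_ (map-constant len (long M) (long-spans M))
                                                          (map-constant len (short M) (All.map unit (short-spans M))) ⟩
    replicate (length (long M)) x ++ replicate (length (short M)) 1
                                            ≡⟨ cong₂ (λ c p → replicate c x ++ replicate p 1) (long-count M) (short-count M) ⟩
    replicate (n ∸ a) x ++ replicate a 1    ↭⟨ ++-comm (replicate (n ∸ a) x) (replicate a 1) ⟩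
    replicate a 1 ++ replicate (n ∸ a) x    ∎
    where open PermutationReasoning

block : ∀ d s j h → d ≡ j + (h + h) → Matching (_spans d) (range s (d + j)) j h
block d s j h d≡ = reshape V↭ (+-identityʳ j) refl (chords-matching d s j ∪ pairs-matching (s + j) h)
  where
  open PermutationReasoning
  V↭ = begin
    (range s j ++ range (s + d) j) ++ range (s + j) (h + h)
      ↭⟨ solve 3 (λ A B C → (A ⊕ B) ⊕ C ⊜ (A ⊕ C) ⊕ B) ↭-refl
           (range s j) (range (s + d) j) (range (s + j) (h + h)) ⟩
    (range s j ++ range (s + j) (h + h)) ++ range (s + d) j
      ≡⟨ cong (_++ range (s + d) j) (trans (range-++ s j (h + h)) (cong (range s) (sym d≡))) ⟩
    range s d ++ range (s + d) j
      ≡⟨ range-++ s d j ⟩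
    range s (d + j) ∎

consecutive : ∀ {L c p c' p'} s w w' → Matching L (range s w) c p → Matching L (range (s + w) w') c' p' →
              Matching L (range s (w + w')) (c + c') (p + p')
consecutive s w w' M N = reshape (↭-reflexive (range-++ s w w')) refl refl (M ∪ N)

full-blocks : ∀ d s q → Matching (_spans d) (range s (q * (d + d))) (q * d) 0
full-blocks d s zero    = no-edges
full-blocks d s (suc q) = consecutive s (d + d) (q * (d + d))
  (block d s d 0 (sym (+-identityʳ d))) (full-blocks d (s + (d + d)) q)

linear-layout-odd : ∀ d q r h t → d ≡ r + (h + h) →
  Matching (_spans d) (range 0 (2 * ((q * d + r) + (h + t)))) (q * d + r) (h + t)
linear-layout-odd .(r + (h + h)) q r h t refl =
  reshape (↭-reflexive (cong (range 0) (width q r h t))) (+-identityʳ _) refl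
    (consecutive 0 (q * (d + d) + (d + r)) (t + t)
      (consecutive 0 (q * (d + d)) (d + r) (full-blocks d 0 q) (block d (q * (d + d)) r h refl))
      (pairs-matching _ t))
  where
  d = r + (h + h)
  width : ∀ q r h t → let d = r + (h + h) in
    q * (d + d) + (d + r) + (t + t) ≡ 2 * ((q * d + r) + (h + t))
  width = solve-∀

linear-layout-even : ∀ d q r h k t → d ≡ r + (h + h) → d ≡ suc (k + k) →
  Matching (_spans d) (range 0 (2 * ((q * d + suc r) + ((h + k) + t)))) (q * d + suc r) ((h + k) + t)
linear-layout-even .(r + (h + h)) q r h k t refl d≡ =
  reshape (↭-reflexive (cong (range 0) width)) (count q d r) refl
    (consecutive 0 (q * (d + d) + (d + r) + (d + 1)) (t + t)
      (consecutive 0 (q * (d + d) + (d + r)) (d + 1)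
        (consecutive 0 (q * (d + d)) (d + r) (full-blocks d 0 q) (block d (q * (d + d)) r h refl))
        (block d _ 1 k d≡))
      (pairs-matching _ t))
  where
  d = r + (h + h)
  count : ∀ q d r → q * d + r + 1 + 0 ≡ q * d + suc r
  count = solve-∀
  widthₖ : ∀ q r h k t → let d = r + (h + h) in
    q * (d + d) + (d + r) + (suc (k + k) + 1) + (t + t) ≡ 2 * ((q * d + suc r) + ((h + k) + t))
  widthₖ = solve-∀
  width = trans (cong (λ z → q * (d + d) + (d + r) + (z + 1) + (t + t)) d≡) (widthₖ q r h k t)

recount : ∀ {d c c' p} → c ≡ c' →
  Matching (_spans d) (range 0 (2 * (c + p))) c p → Matching (_spans d) (range 0 (2 * (c' + p))) c' p
recount refl M = M

linear-matching : ∀ k c p → suc (k + k) ≤ p →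
  Matching (_spans (suc (k + k))) (range 0 (2 * (suc c + p))) (suc c) p
linear-matching k c p d≤p with divide c (suc (k + k))
... | q , ρ , ρ<d , refl with parity ρ
...   | inj₁ (σ , refl) with m≤n⇒∃[o]m+o≡n (half-≤ {σ} {k} (<⇒≤ ρ<d))
...     | h , refl with m≤n⇒∃[o]m+o≡n (≤-trans (m≤n+m h σ) (≤-trans (n≤1+n _) (≤-trans (m≤m+n _ _) d≤p)))
...       | t , refl = recount (+-suc (q * suc (k + k)) (σ + σ))
  (linear-layout-odd _ q (suc (σ + σ)) h t (odd-split σ h))
linear-matching k c p d≤p | q , ρ , ρ<d , refl | inj₂ (σ , refl)
  with m≤n⇒∃[o]m+o≡n (half-≤ {σ} {k} (≤-trans (n≤1+n _) (<⇒≤ ρ<d)))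
... | h , refl with m≤n⇒∃[o]m+o≡n (≤-trans (+-monoˡ-≤ _ (m≤n+m h σ)) (≤-trans (n≤1+n _) d≤p))
...   | t , refl = recount (+-suc (q * suc (k + k)) (suc (σ + σ)))
  (linear-layout-even _ q (suc (σ + σ)) h (σ + h) t (odd-split σ h) refl)

module Doubling (M : ℕ) where

  cross-forward cross-backward parallel : Edge → Edge
  cross-forward  (u , w) = (u , M + w)
  cross-backward (u , w) = (w , M + u)
  parallel       (u , w) = (M + u , M + w)

  crossed-endpoints : ∀ F → endpoints (map cross-backward F) ++ endpoints (map cross-forward F)
                          ↭ endpoints F ++ map (M +_) (endpoints F)
  crossed-endpoints []            = ↭-refl
  crossed-endpoints ((u , w) ∷ F) = begin
    ([ w ] ++ [ M + u ] ++ A) ++ ([ u ] ++ [ M + w ] ++ B)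
      ↭⟨ solve 6 (λ w Mu A u Mw B → (w ⊕ (Mu ⊕ A)) ⊕ (u ⊕ (Mw ⊕ B)) ⊜ ((u ⊕ w) ⊕ (Mu ⊕ Mw)) ⊕ (A ⊕ B))
           ↭-refl [ w ] [ M + u ] A [ u ] [ M + w ] B ⟩
    ([ u ] ++ [ w ] ++ [ M + u ] ++ [ M + w ]) ++ (A ++ B)
      ↭⟨ ↭-++⁺ˡ ([ u ] ++ [ w ] ++ [ M + u ] ++ [ M + w ]) (crossed-endpoints F) ⟩
    ([ u ] ++ [ w ] ++ [ M + u ] ++ [ M + w ]) ++ (C ++ D)
      ↭⟨ solve 6 (λ u w Mu Mw C D → ((u ⊕ w) ⊕ (Mu ⊕ Mw)) ⊕ (C ⊕ D) ⊜ (u ⊕ (w ⊕ C)) ⊕ (Mu ⊕ (Mw ⊕ D)))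
           ↭-refl [ u ] [ w ] [ M + u ] [ M + w ] C D ⟩
    ([ u ] ++ [ w ] ++ C) ++ ([ M + u ] ++ [ M + w ] ++ D) ∎
    where
    open PermutationReasoning
    A = endpoints (map cross-backward F)
    B = endpoints (map cross-forward F)
    C = endpoints F
    D = map (M +_) (endpoints F)

  parallel-endpoints : ∀ F → endpoints (map parallel F) ≡ map (M +_) (endpoints F)
  parallel-endpoints []            = refl
  parallel-endpoints ((u , w) ∷ F) = cong (λ l → M + u ∷ M + w ∷ l) (parallel-endpoints F)

  doubled-covers : ∀ F G → endpoints F ++ endpoints G ↭ range 0 M →
    endpoints (map cross-backward F ++ map cross-forward F) ++ endpoints (G ++ map parallel G) ↭ range 0 (M + M)
  doubled-covers F G covers-F∪G = begin
    endpoints (map cross-backward F ++ map cross-forward F) ++ endpoints (G ++ map parallel G)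
      ≡⟨ cong₂ _++_ (endpoints-++ (map cross-backward F) _)
                    (trans (endpoints-++ G _) (cong (endpoints G ++_) (parallel-endpoints G))) ⟩
    (endpoints (map cross-backward F) ++ endpoints (map cross-forward F)) ++ (S ++ map (M +_) S)
      ↭⟨ ↭-++⁺ʳ (S ++ map (M +_) S) (crossed-endpoints F) ⟩
    (L ++ map (M +_) L) ++ (S ++ map (M +_) S)
      ↭⟨ interchange L (map (M +_) L) S (map (M +_) S) ⟩
    (L ++ S) ++ (map (M +_) L ++ map (M +_) S)
      ≡⟨ cong ((L ++ S) ++_) (sym (map-++ (M +_) L S)) ⟩
    (L ++ S) ++ map (M +_) (L ++ S)
      ↭⟨ ↭-++⁺ covers-F∪G (↭-map⁺ (M +_) covers-F∪G) ⟩
    range 0 M ++ map (M +_) (range 0 M)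
      ≡⟨ cong (range 0 M ++_) (trans (range-shift M 0 M) (cong (λ s → range s M) (+-identityʳ M))) ⟩
    range 0 M ++ range M M
      ≡⟨ range-++ 0 M M ⟩
    range 0 (M + M) ∎
    where
    open PermutationReasoning
    L = endpoints F
    S = endpoints G

  double : ∀ {d c p} → d ≤ M → Matching (_spans d) (range 0 M) c p →
           Matching (λ e → e spans (M ∸ d) ⊎ e spans (M + d)) (range 0 (M + M)) (c + c) (p + p)
  double {d} d≤M N = record
    { long        = map cross-backward (long N) ++ map cross-forward (long N)
    ; short       = short N ++ map parallel (short N)
    ; long-spans  = ++⁺ (map⁺ (All.map (inj₁ ∘ backward-spans) (long-spans N)))
                        (map⁺ (All.map (inj₂ ∘ forward-spans) (long-spans N)))
    ; short-spans = ++⁺ (short-spans N) (map⁺ (All.map parallel-spans (short-spans N)))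
    ; long-count  = trans (length-++ (map cross-backward (long N)))
                          (cong₂ _+_ (mapped-count cross-backward (long N) (long-count N))
                                     (mapped-count cross-forward (long N) (long-count N)))
    ; short-count = trans (length-++ (short N))
                          (cong₂ _+_ (short-count N) (mapped-count parallel (short N) (short-count N)))
    ; covers      = doubled-covers (long N) (short N) (covers N)
    }
    where
    forward-spans : ∀ {e} → e spans d → cross-forward e spans (M + d)
    forward-spans {u , _} refl = trans (sym (+-assoc M u d)) (trans (cong (_+ d) (+-comm M u)) (+-assoc u M d))
    backward-spans : ∀ {e} → e spans d → cross-backward e spans (M ∸ d)
    backward-spans {u , _} refl =
      trans (+-comm M u) (trans (cong (u +_) (sym (m+[n∸m]≡n d≤M))) (sym (+-assoc u d (M ∸ d))))
    parallel-spans : ∀ {e} → e spans 1 → parallel e spans 1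
    parallel-spans {u , _} refl = sym (+-assoc M u 1)
    mapped-count : ∀ (f : Edge → Edge) F {k} → length F ≡ k → length (map f F) ≡ k
    mapped-count f F F≡k = trans (length-map f F) F≡k

rows : ℕ → ℕ → ℕ → List ℕ
rows m u w = range u w ++ range (m + u) w

beside : ∀ {L c p c' p'} m u w w' → Matching L (rows m u w) c p → Matching L (rows m (u + w) w') c' p' →
         Matching L (rows m u (w + w')) (c + c') (p + p')
beside m u w w' M N = reshape V↭ refl refl (M ∪ N)
  where
  V↭ = ↭-trans (interchange (range u w) (range (m + u) w) (range (u + w) w') (range (m + (u + w)) w'))
         (↭-reflexive (cong₂ _++_ (range-++ u w w') (range-join (sym (+-assoc m u w)))))

close-rows : ∀ {L c p} m W t t' N → m ≡ W + (t + t) → N ≡ m + (W + (t' + t')) →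
             Matching L (rows m 0 W) c p → Matching L (range 0 N) c (p + (t + t'))
close-rows m W t t' N m≡ N≡ M =
  reshape V↭ (+-identityʳ _) refl (M ∪ (pairs-matching W t ∪ pairs-matching (m + W) t'))
  where
  open PermutationReasoning
  V↭ = begin
    (range 0 W ++ range (m + 0) W) ++ (range W (t + t) ++ range (m + W) (t' + t'))
      ↭⟨ interchange (range 0 W) (range (m + 0) W) (range W (t + t)) (range (m + W) (t' + t')) ⟩
    (range 0 W ++ range W (t + t)) ++ (range (m + 0) W ++ range (m + W) (t' + t'))
      ≡⟨ cong₂ _++_ (range-++ 0 W (t + t)) (range-join (cong (_+ W) (sym (+-identityʳ m)))) ⟩
    range 0 (W + (t + t)) ++ range (m + 0) (W + (t' + t'))
      ≡⟨ range-join (trans (+-identityʳ m) m≡) ⟩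
    range 0 ((W + (t + t)) + (W + (t' + t')))
      ≡⟨ cong (range 0) (trans (cong (_+ (W + (t' + t'))) (sym m≡)) (sym N≡)) ⟩
    range 0 N ∎

Chord : ℕ → ℕ → Edge → Set
Chord x e d = d spans x ⊎ d spans (x + (e + e))

-- With m = x + E, the top row sends r chords of difference x + 2(E + 1) down to the end of the
-- bottom row and r + 2 chords of difference x down to its start; 2f unit edges fill the gaps.
cross : ∀ x E u r f → E ≡ r + (f + f) →
  Matching (Chord x (suc E)) (rows (x + E) u (r + (f + f) + (r + 2))) (r + (r + 2)) (f + f)
cross x .(r + (f + f)) u r f refl = reshape V↭ (long≡ r) (cong (_+ f) (+-identityʳ f))
  (((weaken inj₂ (chords-matching y u r) ∪ pairs-matching (u + r) f)
    ∪ weaken inj₁ (chords-matching x (u + E) (r + 2)))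
    ∪ pairs-matching (x + E + u + (r + 2)) f)
  where
  E = r + (f + f)
  y = x + (suc E + suc E)
  open PermutationReasoning
  A = range u r
  B = range (u + y) r
  C = range (u + r) (f + f)
  D = range (u + E) (r + 2)
  G = range (u + E + x) (r + 2)
  H = range (x + E + u + (r + 2)) (f + f)
  long≡ : ∀ r → r + 0 + (r + 2) + 0 ≡ r + (r + 2)
  long≡ = solve-∀
  x-end : ∀ x r f u → x + (r + (f + f)) + u ≡ u + (r + (f + f)) + x
  x-end = solve-∀
  y-end : ∀ x r f u → u + (x + (suc (r + (f + f)) + suc (r + (f + f))))
                    ≡ u + (r + (f + f)) + x + ((r + 2) + (f + f))
  y-end = solve-∀
  width : ∀ r f → r + 2 + (f + f) + r ≡ r + (f + f) + (r + 2)
  width = solve-∀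
  V↭ = begin
    (((A ++ B) ++ C) ++ (D ++ G)) ++ H
      ↭⟨ solve 6 (λ A B C D G H → (((A ⊕ B) ⊕ C) ⊕ (D ⊕ G)) ⊕ H ⊜ ((A ⊕ C) ⊕ D) ⊕ ((G ⊕ H) ⊕ B))
           ↭-refl A B C D G H ⟩
    ((A ++ C) ++ D) ++ ((G ++ H) ++ B)
      ≡⟨ cong₂ _++_ (trans (cong (_++ D) (range-++ u r (f + f))) (range-++ u (r + (f + f)) (r + 2)))
                    (trans (cong (_++ B) (range-join (cong (_+ (r + 2)) (x-end x r f u)))) (range-join (y-end x r f u))) ⟩
    range u (r + (f + f) + (r + 2)) ++ range (u + E + x) (r + 2 + (f + f) + r)
      ≡⟨ cong (range u (r + (f + f) + (r + 2)) ++_) (cong₂ range (sym (x-end x r f u)) (width r f)) ⟩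
    rows (x + E) u (r + (f + f) + (r + 2)) ∎

-- Every cross carries r + (r + 2) ≡ 0 (mod 4) chords; this piece carries two.
parity-piece : ∀ x g u → let E = suc (g + g) in
  Matching (Chord x (suc E)) (rows (x + E) u (3 + E)) 2 (suc g + suc g)
parity-piece x g u = reshape V↭ refl (short≡ g)
  ((((weaken inj₂ (chords-matching y u 1) ∪ pairs-matching (suc u) (suc g))
     ∪ weaken inj₁ (chords-matching x (u + (E + 2)) 1))
     ∪ pairs-matching (x + E + u) 1)
     ∪ pairs-matching (x + E + u + 3) g)
  where
  E = suc (g + g)
  y = x + (suc E + suc E)
  open PermutationReasoning
  A = range u 1
  B = range (u + y) 1
  C = range (suc u) (suc g + suc g)
  D = range (u + (E + 2)) 1
  G = range (u + (E + 2) + x) 1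
  H = range (x + E + u) 2
  I = range (x + E + u + 3) (g + g)
  short≡ : ∀ g → suc g + 0 + 1 + g ≡ suc g + suc g
  short≡ = solve-∀
  x-start : ∀ g u → u + (suc (g + g) + 2) ≡ u + (1 + (suc g + suc g))
  x-start = solve-∀
  x-end : ∀ x g u → u + (suc (g + g) + 2) + x ≡ x + suc (g + g) + u + 2
  x-end = solve-∀
  y-end : ∀ x g u → let E = suc (g + g) in u + (x + (suc E + suc E)) ≡ x + E + u + (3 + (g + g))
  y-end = solve-∀
  top-width : ∀ g → 1 + (suc g + suc g) + 1 ≡ 3 + suc (g + g)
  top-width = solve-∀
  bottom-width : ∀ g → 2 + 1 + (g + g) + 1 ≡ 3 + suc (g + g)
  bottom-width = solve-∀
  V↭ = begin
    ((((A ++ B) ++ C) ++ (D ++ G)) ++ H) ++ I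
      ↭⟨ solve 7 (λ A B C D G H I → ((((A ⊕ B) ⊕ C) ⊕ (D ⊕ G)) ⊕ H) ⊕ I ⊜ ((A ⊕ C) ⊕ D) ⊕ (((H ⊕ G) ⊕ I) ⊕ B))
           ↭-refl A B C D G H I ⟩
    ((A ++ C) ++ D) ++ (((H ++ G) ++ I) ++ B)
      ≡⟨ cong₂ _++_ (trans (cong (_++ D) (range-join {u} {1} {suc u} {suc g + suc g} (+-comm 1 u)))
                           (range-join {u} {1 + (suc g + suc g)} {u + (E + 2)} {1} (x-start g u)))
                    (trans (cong (λ l → (l ++ I) ++ B) (range-join {x + E + u} {2} {u + (E + 2) + x} {1} (x-end x g u)))
                      (trans (cong (_++ B) (range-join {x + E + u} {2 + 1} {x + E + u + 3} {g + g} refl))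
                        (range-join {x + E + u} {2 + 1 + (g + g)} {u + y} {1} (y-end x g u)))) ⟩
    range u (1 + (suc g + suc g) + 1) ++ range (x + E + u) (2 + 1 + (g + g) + 1)
      ≡⟨ cong₂ (λ w w' → range u w ++ range (x + E + u) w') (top-width g) (bottom-width g) ⟩
    rows (x + E) u (3 + E) ∎

-- The two-row layout for even e = E + 1: the top row is [0, m) with m = x + E = n − 1.
module Twisted (x g : ℕ) where

  E = suc (g + g)
  e = suc E
  m = x + E

  full-crosses : ∀ u K → Matching (Chord x (suc E)) (rows m u (K * (e + e))) (K * (e + e)) 0
  full-crosses u zero    = no-edges
  full-crosses u (suc K) = beside m u (e + e) (K * (e + e)) full (full-crosses (u + (e + e)) K)
    where
    full-width : ∀ E → E + (0 + 0) + (E + 2) ≡ suc E + suc E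
    full-width = solve-∀
    full-count : ∀ E → E + (E + 2) ≡ suc E + suc E
    full-count = solve-∀
    full = reshape (↭-reflexive (cong (rows m u) (full-width E))) (full-count E) refl
                   (cross x E u E 0 (sym (+-identityʳ E)))

  crosses : ∀ u K σ h → g ≡ σ + h → let r = suc (σ + σ) in
    Matching (Chord x (suc E)) (rows m u (K * (e + e) + (r + (h + h) + (r + 2))))
             (K * (e + e) + (r + (r + 2))) (h + h)
  crosses u K σ h refl = beside m u (K * (e + e)) _ (full-crosses u K)
    (cross x E (u + K * (e + e)) (suc (σ + σ)) h (odd-split σ h))

  close : ∀ {c p} W t → m ≡ W + (t + t) →
    Matching (Chord x (suc E)) (rows m 0 W) c p → Matching (Chord x (suc E)) (range 0 (2 * (x + e))) c (p + (t + suc t))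
  close W t m≡ = close-rows m W t (suc t) (2 * (x + e)) m≡
    (trans (double-suc x E) (cong (m +_) (trans (cong (λ z → suc (suc z)) m≡) (gap W t))))
    where
    double-suc : ∀ x E → 2 * (x + suc E) ≡ (x + E) + suc (suc (x + E))
    double-suc = solve-∀
    gap : ∀ W t → suc (suc (W + (t + t))) ≡ W + (suc t + suc t)
    gap = solve-∀

  twisted : ∀ {n a b} K σ h t → g ≡ σ + h → let r = suc (σ + σ) in
    n ≡ x + e → n ≡ a + b → a ≡ suc ((h + t) + (h + t)) → b ≡ K * (e + e) + (r + (r + 2)) →
    Matching (Chord x (suc E)) (range 0 (2 * n)) b a
  twisted K σ h t g≡ refl n≡ refl refl =
    reshape ↭-refl refl (ones h t) (close W t m≡ (crosses 0 K σ h g≡))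
    where
    r = suc (σ + σ)
    W = K * (e + e) + (r + (h + h) + (r + 2))
    ones : ∀ h t → h + h + (t + suc t) ≡ suc ((h + t) + (h + t))
    ones = solve-∀
    balance : ∀ E K σ h t → let r = suc (σ + σ) in
      suc ((h + t) + (h + t)) + (K * (suc E + suc E) + (r + (r + 2)))
        ≡ suc (K * (suc E + suc E) + (r + (h + h) + (r + 2)) + (t + t))
    balance = solve-∀
    m≡ = suc-injective (trans (sym (+-suc x E)) (trans n≡ (balance E K σ h t)))

  twisted-with-parity-piece : ∀ {n a b} K σ h t → g ≡ σ + h → let r = suc (σ + σ) in
    n ≡ x + e → n ≡ a + b → a ≡ suc ((suc g + h + t) + (suc g + h + t)) →
    b ≡ 2 + (K * (e + e) + (r + (r + 2))) →
    Matching (Chord x (suc E)) (range 0 (2 * n)) b a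
  twisted-with-parity-piece K σ h t g≡ refl n≡ refl refl =
    reshape ↭-refl refl (ones g h t)
      (close W t m≡ (beside m 0 (3 + E) _ (parity-piece x g 0) (crosses (3 + E) K σ h g≡)))
    where
    r = suc (σ + σ)
    W = 3 + E + (K * (e + e) + (r + (h + h) + (r + 2)))
    ones : ∀ g h t → suc g + suc g + (h + h) + (t + suc t) ≡ suc ((suc g + h + t) + (suc g + h + t))
    ones = solve-∀
    balance : ∀ g K σ h t → let E = suc (g + g) ; r = suc (σ + σ) in
      suc ((suc g + h + t) + (suc g + h + t)) + (2 + (K * (suc E + suc E) + (r + (r + 2))))
        ≡ suc (3 + E + (K * (suc E + suc E) + (r + (h + h) + (r + 2))) + (t + t))
    balance = solve-∀
    m≡ = suc-injective (trans (sym (+-suc x E)) (trans n≡ (balance g K σ h t)))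

module Construction {n a b k e′ : ℕ} (n≡a+b : n ≡ a + b) (n≡x+e : n ≡ suc (k + k) + suc e′)
                    (1≤b : 1 ≤ b) (b≤a : b ≤ a) where

  x = suc (k + k)
  e = suc e′

  Goal : Set
  Goal = Matching (HasLength (2 * n) x) (range 0 (2 * n)) b a

  x≤n : x ≤ n
  x≤n = subst (x ≤_) (sym n≡x+e) (m≤m+n x e)

  x≤a+a : x ≤ a + a
  x≤a+a = ≤-trans x≤n (subst (_≤ a + a) (sym n≡a+b) (+-monoʳ-≤ a b≤a))

  x+x≤2n : x + x ≤ 2 * n
  x+x≤2n = subst (x + x ≤_) (cong (n +_) (sym (+-identityʳ n))) (+-mono-≤ x≤n x≤n)

  from-linear : Matching (_spans x) (range 0 (2 * (b + a))) b a → Goal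
  from-linear M = reshape (↭-reflexive (cong (λ z → range 0 (2 * z)) (trans (+-comm b a) (sym n≡a+b)))) refl refl
    (weaken (spans⇒length x+x≤2n) M)

  via-linear : x ≤ a → Goal
  via-linear x≤a with m≤n⇒∃[o]m+o≡n 1≤b
  ... | b′ , refl = from-linear (linear-matching k b′ a x≤a)

  via-one-block : ∀ β → b ≡ suc (β + β) → b < x → Goal
  via-one-block β refl b<x with m≤n⇒∃[o]m+o≡n (half-≤ {β} {k} (≤-trans (n≤1+n _) (<⇒≤ b<x)))
  ... | h , refl
    with m≤n⇒∃[o]m+o≡n (≤-trans (m≤n+m h β) (half-≤ {k} {a} (≤-trans (n≤1+n _) (≤-trans x≤a+a (n≤1+n _)))))
  ...   | t , refl = from-linear (linear-layout-odd x 0 b h t (odd-split β h))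

  via-two-blocks : ∀ γ → b ≡ suc γ + suc γ → b < x → x ≤ a + suc γ → Goal
  via-two-blocks γ refl b<x x≤a+c
    with m≤n⇒∃[o]m+o≡n (half-≤ {γ} {k} (≤-trans (+-mono-≤ (n≤1+n γ) (n≤1+n γ)) (<⇒≤ b<x)))
  ... | h , refl
    with m≤n⇒∃[o]m+o≡n (+-cancelˡ-≤ (suc γ) _ _ (subst₂ _≤_ (odd-regroup γ h) (+-comm a (suc γ)) x≤a+c))
  ...   | t , refl = from-linear (recount (cong suc (sym (+-suc γ γ)))
                                   (linear-layout-even x 0 (suc (γ + γ)) h (γ + h) t (odd-split γ h) refl))

  e<half-b : ∀ c → b ≡ c + c → a + c < x → e < c
  e<half-b c refl a+c<x = +-cancelˡ-< x e c (subst (_< x + c) gap (+-monoˡ-< c a+c<x))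
    where
    gap : a + c + c ≡ x + e
    gap = trans (+-assoc a c c) (trans (sym n≡a+b) n≡x+e)

  via-doubling : ∀ σ γ → e′ ≡ σ + σ → b ≡ suc γ + suc γ → a + suc γ < x → Goal
  via-doubling σ γ refl refl a+c<x with parity a
  -- n = x + e is even, hence so is a.
  ... | inj₂ (α , refl) = contradiction (trans (even-n k σ) (trans (sym n≡x+e) (trans n≡a+b (odd-n α γ))))
                                        (even≢odd (suc (k + σ)) (α + suc γ))
    where
    even-n : ∀ k σ → 2 * suc (k + σ) ≡ suc (k + k) + suc (σ + σ)
    even-n = solve-∀
    odd-n : ∀ α γ → suc (α + α) + (suc γ + suc γ) ≡ suc (2 * (α + suc γ))
    odd-n = solve-∀
  ... | inj₁ (α , refl) =
    reshape (↭-reflexive (cong (range 0) (trans (cong₂ _+_ M≡n M≡n) (sym (two-times n))))) refl refl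
    (weaken to-length (Doubling.double M e≤M (linear-matching σ γ α e≤α)))
    where
    M = 2 * (suc γ + α)
    two-times : ∀ n → 2 * n ≡ n + n
    two-times = solve-∀
    M≡n : M ≡ n
    M≡n = trans (halves γ α) (sym n≡a+b)
      where
      halves : ∀ γ α → 2 * (suc γ + α) ≡ α + α + (suc γ + suc γ)
      halves = solve-∀
    M∸e≡x : M ∸ e ≡ x
    M∸e≡x = trans (cong (_∸ e) (trans M≡n n≡x+e)) (m+n∸n≡m x e)
    x+[M+e]≡2n : x + (M + e) ≡ 2 * n
    x+[M+e]≡2n = trans (cong (λ z → x + (z + e)) M≡n)
                       (trans (rotate x e n) (trans (cong (n +_) (sym n≡x+e)) (sym (two-times n))))
      where
      rotate : ∀ x e n → x + (n + e) ≡ n + (x + e)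
      rotate = solve-∀
    to-length : ∀ {d} → d spans (M ∸ e) ⊎ d spans (M + e) → HasLength (2 * n) x d
    to-length {d} = chord-length x+[M+e]≡2n (≤-trans x≤n (≤-trans (≤-reflexive (sym M≡n)) (m≤m+n M e)))
                    ∘ Sum.map₁ (subst (d spans_) M∸e≡x)
    e≤α : e ≤ α
    e≤α = ≤-trans (<⇒≤ (e<half-b (suc γ) refl a+c<x)) (half-≤ (≤-trans b≤a (n≤1+n _)))
    e≤M : e ≤ M
    e≤M = ≤-trans e≤α (≤-trans (m≤n+m α (suc γ)) (m≤m+n _ _))

  twisted-length : ∀ {d} → Chord x e d → HasLength (2 * n) x d
  twisted-length = chord-length (trans (both x e) (cong (2 *_) (sym n≡x+e))) (m≤m+n x (e + e))
    where
    both : ∀ x e → x + (x + (e + e)) ≡ 2 * (x + e)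
    both = solve-∀

  g≤e : ∀ g → g ≤ suc (suc (g + g))
  g≤e g = ≤-trans (m≤m+n g g) (≤-trans (n≤1+n _) (n≤1+n _))

  via-twisted : ∀ g γ → e′ ≡ suc (g + g) → b ≡ suc γ + suc γ → a + suc γ < x → Goal
  via-twisted g zero    refl refl a+c<x = contradiction (e<half-b 1 refl a+c<x) λ { (s≤s ()) }
  via-twisted g (suc γ′) refl refl a+c<x with parity a
  -- n = x + e is odd, hence so is a.
  ... | inj₁ (α , refl) = contradiction (trans (even-n α (suc γ′)) (trans (sym n≡a+b) (trans n≡x+e (odd-n k g))))
                                        (even≢odd (α + suc (suc γ′)) (k + suc g))
    where
    even-n : ∀ α γ → 2 * (α + suc γ) ≡ α + α + (suc γ + suc γ)
    even-n = solve-∀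
    odd-n : ∀ k g → suc (k + k) + suc (suc (g + g)) ≡ suc (2 * (k + suc g))
    odd-n = solve-∀
  ... | inj₂ (α , refl) with e<half-b (suc (suc γ′)) refl a+c<x | divide γ′ e
  ...   | e<c | K , ρ , ρ<e , refl with parity ρ
  ...       | inj₁ (σ , refl) with m≤n⇒∃[o]m+o≡n (half-≤ {σ} {g} (≤-pred ρ<e))
  ...         | h , refl
    with m≤n⇒∃[o]m+o≡n {h} {α} (≤-trans (m≤n+m h σ) (≤-trans (g≤e (σ + h)) (≤-trans (<⇒≤ e<c) (half-≤ b≤a))))
  ...           | t , refl = weaken twisted-length
    (Twisted.twisted x (σ + h) K σ h t refl n≡x+e n≡a+b refl (count K e σ))
    where
    count : ∀ K e σ → suc (suc (K * e + (σ + σ))) + suc (suc (K * e + (σ + σ)))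
                      ≡ K * (e + e) + (suc (σ + σ) + (suc (σ + σ) + 2))
    count = solve-∀
  via-twisted g (suc γ′) refl refl a+c<x | inj₂ (α , refl) | e<c | K , ρ , ρ<e , refl | inj₂ (σ , refl)
    with m≤n⇒∃[o]m+o≡n (half-≤ {σ} {g} (≤-trans (n≤1+n _) (≤-pred ρ<e)))
  ... | h , refl with m≤n⇒∃[o]m+o≡n {suc (σ + h) + h} {α}
    (≤-trans (+-monoʳ-≤ (suc (σ + h)) (m≤n+m h σ)) (≤-trans (n≤1+n _) (≤-trans (<⇒≤ e<c) (half-≤ b≤a))))
  ...   | t , refl = weaken twisted-length
    (Twisted.twisted-with-parity-piece x (σ + h) K σ h t refl n≡x+e n≡a+b refl (count K e σ))
    where
    count : ∀ K e σ → suc (suc (K * e + suc (σ + σ))) + suc (suc (K * e + suc (σ + σ)))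
                      ≡ 2 + (K * (e + e) + (suc (σ + σ) + (suc (σ + σ) + 2)))
    count = solve-∀

  matching : Goal
  matching with x ≤? a
  ... | yes x≤a = via-linear x≤a
  ... | no  x≰a with parity b
  ...   | inj₂ (β , b≡) = via-one-block β b≡ (≤-<-trans b≤a (≰⇒> x≰a))
  ...   | inj₁ (zero , refl) = contradiction 1≤b λ ()
  ...   | inj₁ (suc γ , b≡) with x ≤? a + suc γ
  ...     | yes x≤a+c = via-two-blocks γ b≡ (≤-<-trans b≤a (≰⇒> x≰a)) x≤a+c
  ...     | no  x≰a+c with parity e′
  ...       | inj₁ (σ , e≡) = via-doubling σ γ e≡ b≡ (≰⇒> x≰a+c)
  ...       | inj₂ (g , e≡) = via-twisted g γ e≡ b≡ (≰⇒> x≰a+c)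

lemma3p4 : (n x a k : ℕ) → x ≡ 2 * k + 1 → 1 < x → x < n → n ≤ 2 * a → a < n →
    Σ[ F ∈ List Edge ] (IsPerfectMatching (2 * n) F ×
    (lengths (2 * n) F ↭ (replicate a 1 ++ replicate (n ∸ a) x)))
lemma3p4 n x a k x≡2k+1 _ x<n n≤2a a<n =
  matching⇒solution (≤-trans (s≤s z≤n) a<n)
    (subst (λ x → Matching (HasLength (2 * n) x) (range 0 (2 * n)) (n ∸ a) a) x≡
      (Construction.matching {k = k} n≡a+b n≡x+e (m<n⇒0<n∸m a<n) b≤a))
  where
  x≡ : suc (k + k) ≡ x
  x≡ = trans (odd k) (sym x≡2k+1)
    where
    odd : ∀ k → suc (k + k) ≡ 2 * k + 1
    odd = solve-∀
  e′ = proj₁ (m≤n⇒∃[o]m+o≡n x<n)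
  n≡x+e : n ≡ suc (k + k) + suc e′
  n≡x+e = sym (trans (+-suc (suc (k + k)) e′)
                     (trans (cong (λ z → suc z + e′) x≡) (proj₂ (m≤n⇒∃[o]m+o≡n x<n))))
  n≡a+b : n ≡ a + (n ∸ a)
  n≡a+b = sym (m+[n∸m]≡n (<⇒≤ a<n))
  b≤a : n ∸ a ≤ a
  b≤a = ≤-trans (∸-monoˡ-≤ a n≤2a) (≤-reflexive (trans (m+n∸m≡n a (a + 0)) (+-identityʳ a)))
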